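{- Let $G$ be a finite, simple, connected graph of order $n$ which is randomly $k$-dimensional for some $k$, and suppose $G\neq K_n$. Then for every pair of distinct vertices $u,v\in V(G)$, $N(v)\setminus\{u\}\neq N(u)\setminus\{v\}$.
   Context: $d(x,y)$ is the distance in $G$, $N(v)$ the neighbourhood of $v$. For an ordered set $W=\{w_1,\ldots,w_k\}\subseteq V(G)$ and $v\in V(G)$, $r(v|W)=(d(v,w_1),\ldots,d(v,w_k))$. $W$ is a resolving set if distinct vertices have distinct representations with respect to $W$. The metric dimension $\beta(G)$ is the minimum size of a resolving set; a resolving set of size $\beta(G)$ is a basis. $G$ is randomly $k$-dimensional if $\beta(G)=k$ and every $k$-subset of $V(G)$ is a basis of $G$ (equivalently every $k$-subset is a resolving set and $\beta(G)=k$). -}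

module Defs where

open import Data.Nat using (ℕ; zero; suc; _<_; _≥_)
open import Data.Fin using (Fin)
open import Data.Bool using (Bool; true)
open import Data.Vec using (tabulate)
open import Data.Fin.Subset using (Subset; _∈_; ∣_∣; _─_; ⁅_⁆)
open import Data.Product using (_×_; ∃)
open import Relation.Binary.PropositionalEquality using (_≡_; _≢_)
open import Relation.Nullary using (¬_)

record Graph (n : ℕ) : Set where
  field
    adj   : Fin n → Fin n → Bool
    sym   : ∀ u v → adj u v ≡ adj v u
    irrefl : ∀ v → adj v v ≢ true
open Graph public

module _ {n : ℕ} (G : Graph n) where

  Adj : Fin n → Fin n → Set
  Adj u v = adj G u v ≡ true

  data Walk : Fin n → Fin n → ℕ → Set where
    [] : ∀ {u} → Walk u u zero
    _∷_ : ∀ {u v w ℓ} → Adj u v → Walk v w ℓ → Walk u w (suc ℓ)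

  Connected : Set
  Connected = ∀ u v → ∃ λ ℓ → Walk u v ℓ

  IsDist : Fin n → Fin n → ℕ → Set
  IsDist u v m = Walk u v m × (∀ ℓ → Walk u v ℓ → ℓ ≥ m)

  SameDist : Fin n → Fin n → Fin n → Set
  SameDist u v w = ∃ λ m → IsDist u w m × IsDist v w m

  -- W resolving: equal representations r(u|W) = r(v|W) force u = v
  Resolving : Subset n → Set
  Resolving W = ∀ u v → (∀ w → w ∈ W → SameDist u v w) → u ≡ v

  MetricDim : ℕ → Set
  MetricDim k = (∃ λ W → Resolving W × ∣ W ∣ ≡ k)
              × (∀ W → Resolving W → ∣ W ∣ ≥ k)

  RandomlyDim : ℕ → Set
  RandomlyDim k = MetricDim k × (∀ W → ∣ W ∣ ≡ k → Resolving W)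

  Complete : Set
  Complete = ∀ u v → u ≢ v → Adj u v

  N : Fin n → Subset n
  N v = tabulate λ x → x ∈ₛ v
    where
    open import Data.Fin.Subset using (Side; inside; outside)
    _∈ₛ_ : Fin n → Fin n → Side
    x ∈ₛ v with adj G v x
    ... | true = inside
    ... | _ = outside

-- Twins u, v (that is, N(v) ∖ {u} = N(u) ∖ {v}) have the same distance to every
-- other vertex, so every resolving set contains u or v. A non-complete connected
-- graph has an induced path a – x – y, and then V ∖ {a, x} is resolving: only the
-- pair a, x could fail to be separated, and y separates it since d(x, y) = 1 < d(a, y).
-- Hence β(G) ≤ n − 2, so some k-subset of V ∖ {u, v} exists; in a randomly
-- k-dimensional graph it is a basis containing neither twin, a contradiction.
module Submission where

open import Defs hiding (sym)
open import Data.Bool using (true; false) renaming (_≟_ to _≟ᵇ_)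
open import Data.Empty using (⊥)
open import Data.Fin using (Fin; toℕ; fromℕ<) renaming (_≟_ to _≟ᶠ_)
open import Data.Fin.Properties using (any?; all?; ¬∀⟶∃¬; toℕ<n; toℕ-fromℕ<)
open import Data.Fin.Subset using (Subset; _∈_; _∉_; _⊆_; ∣_∣; ⊤; _─_; _-_; ⁅_⁆; inside; outside)
open import Data.Fin.Subset.Properties
  using (∈⊤; x∈⁅x⁆; x∈p∧x≢y⇒x∈p-y; p─q⊆p; p─⊥≡p; ∣⊤∣≡n; out⊆; s⊆s)
open import Data.Nat using (ℕ; zero; suc; _+_; _∸_; _≤_; _<_; _≥_; z≤n; s≤s; s≤s⁻¹)
open import Data.Nat.Induction using (<-rec)
open import Data.Nat.Properties
  using (≤-antisym; ≤-trans; ≤-refl; n≤1+n; n≤0⇒n≡0; ≮⇒≥; 1+n≰n; m+n∸m≡n)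
open import Data.Product using (∃; ∃₂; _×_; _,_; proj₂)
open import Function using (_∋_)
open import Data.Sum using (_⊎_; inj₁; inj₂)
open import Data.Vec using ([]; _∷_; here; there; lookup)
open import Data.Vec.Properties using (lookup∘tabulate; []=⇒lookup; lookup⇒[]=)
open import Relation.Binary.PropositionalEquality
  using (_≡_; _≢_; refl; sym; trans; cong; subst)
open import Relation.Nullary using (¬_; Dec; yes; no; ¬?; contradiction)
open import Relation.Nullary.Decidable using (_×-dec_; _→-dec_)
open import Relation.Unary using (Decidable)

least : (P : ℕ → Set) → Decidable P → ∀ {ℓ} → P ℓ → ∃ λ m → P m × (∀ j → P j → j ≥ m)
least P P? {ℓ} = <-rec (λ ℓ → P ℓ → ∃ λ m → P m × (∀ j → P j → j ≥ m)) step ℓ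
  where
  step : ∀ ℓ → (∀ {j} → j < ℓ → P j → ∃ λ m → P m × (∀ i → P i → i ≥ m)) →
         P ℓ → ∃ λ m → P m × (∀ j → P j → j ≥ m)
  step ℓ rec Pℓ with any? (λ (j : Fin ℓ) → P? (toℕ j))
  ... | yes (j , Pj) = rec (toℕ<n j) Pj
  ... | no none = ℓ , Pℓ , λ j Pj → ≮⇒≥ λ j<ℓ →
    none (fromℕ< j<ℓ , subst P (sym (toℕ-fromℕ< j<ℓ)) Pj)

x∈q⇒x∉p─q : ∀ {n} {x : Fin n} (p q : Subset n) → x ∈ q → x ∉ p ─ q
x∈q⇒x∉p─q (_ ∷ p) (inside ∷ q) here ()
x∈q⇒x∉p─q (_ ∷ p) (_ ∷ q) (there x∈q) (there x∈p─q) = x∈q⇒x∉p─q p q x∈q x∈p─q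

x∈p⇒suc∣p-x∣≡∣p∣ : ∀ {n} {x : Fin n} (p : Subset n) → x ∈ p → suc ∣ p - x ∣ ≡ ∣ p ∣
x∈p⇒suc∣p-x∣≡∣p∣ (inside ∷ p) here = cong (λ q → suc ∣ q ∣) (p─⊥≡p p)
x∈p⇒suc∣p-x∣≡∣p∣ (inside ∷ p) (there x∈p) = cong suc (x∈p⇒suc∣p-x∣≡∣p∣ p x∈p)
x∈p⇒suc∣p-x∣≡∣p∣ (outside ∷ p) (there x∈p) = x∈p⇒suc∣p-x∣≡∣p∣ p x∈p

∣⊤-x-y∣≡n∸2 : ∀ {n} {x y : Fin n} → x ≢ y → ∣ ⊤ - x - y ∣ ≡ n ∸ 2
∣⊤-x-y∣≡n∸2 {n} {x} {y} x≢y = begin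
  ∣ ⊤ - x - y ∣          ≡⟨ sym (m+n∸m≡n 2 _) ⟩
  2 + ∣ ⊤ - x - y ∣ ∸ 2  ≡⟨ cong (λ m → suc m ∸ 2) (x∈p⇒suc∣p-x∣≡∣p∣ (⊤ - x) y∈⊤-x) ⟩
  suc ∣ ⊤ - x ∣ ∸ 2      ≡⟨ cong (_∸ 2) (x∈p⇒suc∣p-x∣≡∣p∣ (⊤ {n}) ∈⊤) ⟩
  ∣ ⊤ {n} ∣ ∸ 2          ≡⟨ cong (_∸ 2) (∣⊤∣≡n n) ⟩
  n ∸ 2                  ∎
  where
  open Relation.Binary.PropositionalEquality.≡-Reasoning
  y∈⊤-x : y ∈ ⊤ - x
  y∈⊤-x = x∈p∧x≢y⇒x∈p-y ∈⊤ (λ y≡x → x≢y (sym y≡x))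

subset-of-size : ∀ {n k} (p : Subset n) → k ≤ ∣ p ∣ → ∃ λ q → q ⊆ p × ∣ q ∣ ≡ k
subset-of-size [] z≤n = [] , (λ ()) , refl
subset-of-size (outside ∷ p) k≤∣p∣ with subset-of-size p k≤∣p∣
... | q , q⊆p , ∣q∣≡k = outside ∷ q , out⊆ q⊆p , ∣q∣≡k
subset-of-size (inside ∷ p) z≤n with subset-of-size p z≤n
... | q , q⊆p , ∣q∣≡0 = outside ∷ q , out⊆ q⊆p , ∣q∣≡0
subset-of-size (inside ∷ p) (s≤s k≤∣p∣) with subset-of-size p k≤∣p∣
... | q , q⊆p , ∣q∣≡k = inside ∷ q , s⊆s q⊆p , cong suc ∣q∣≡k

InducedP₃ : ∀ {n} → Graph n → Fin n → Fin n → Fin n → Set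
InducedP₃ G a x y = Adj G a x × Adj G x y × a ≢ y × ¬ Adj G a y

module _ {n : ℕ} (G : Graph n) where

  adj? : ∀ u v → Dec (Adj G u v)
  adj? u v = adj G u v ≟ᵇ true

  adj⇒≢ : ∀ {u v} → Adj G u v → u ≢ v
  adj⇒≢ u~v refl = irrefl G _ u~v

  lookup-N : ∀ v x → lookup (N G v) x ≡ adj G v x
  -- Abstracting over adj G v x also reduces the local membership test inside N.
  lookup-N v x with adj G v x | (lookup (N G v) x ≡ _) ∋ lookup∘tabulate _ x
  ... | true  | eq = eq
  ... | false | eq = eq

  adj⇒∈N : ∀ {v x} → Adj G v x → x ∈ N G v
  adj⇒∈N {v} {x} v~x = lookup⇒[]= x (N G v) (trans (lookup-N v x) v~x)

  ∈N⇒adj : ∀ {v x} → x ∈ N G v → Adj G v x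
  ∈N⇒adj {v} {x} x∈Nv = trans (sym (lookup-N v x)) ([]=⇒lookup x∈Nv)

  twins⇒N-u⊆N : ∀ {u v} → N G v ─ ⁅ u ⁆ ≡ N G u ─ ⁅ v ⁆ → N G v - u ⊆ N G u
  twins⇒N-u⊆N {u} {v} twins x∈ = p─q⊆p (N G u) ⁅ v ⁆ (subst (_ ∈_) twins x∈)

  walk? : ∀ m u w → Dec (Walk G u w m)
  walk? zero u w with u ≟ᶠ w
  ... | yes refl = yes []
  ... | no u≢w   = no λ { [] → u≢w refl }
  walk? (suc m) u w with any? (λ x → adj? u x ×-dec walk? m x w)
  ... | yes (x , u~x , p) = yes (u~x ∷ p)
  ... | no none           = no λ { (u~x ∷ p) → none (_ , u~x , p) }

  walk⇒dist : ∀ {u w ℓ} → Walk G u w ℓ → ∃ (IsDist G u w)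
  walk⇒dist {u} {w} = least (Walk G u w) (λ m → walk? m u w)

  dist-refl : ∀ {u m} → IsDist G u u m → m ≡ 0
  dist-refl (_ , minimal) = n≤0⇒n≡0 (minimal 0 [])

  sameDist-sym : ∀ {u v w} → SameDist G u v w → SameDist G v u w
  sameDist-sym (m , du , dv) = m , dv , du

  sameDist-self : ∀ {u v} → SameDist G u v u → u ≡ v
  sameDist-self (_ , du , _) with dist-refl du
  sameDist-self (_ , _ , ([] , _)) | refl = refl

  walk-transfer : ∀ {s t w ℓ} → N G s - t ⊆ N G t → w ≢ s → Walk G s w ℓ →
                  ∃ λ ℓ′ → ℓ′ ≤ ℓ × Walk G t w ℓ′
  walk-transfer _ w≢s [] = contradiction refl w≢s
  walk-transfer {t = t} N-t⊆ _ (_∷_ {v = x} s~x p) with x ≟ᶠ t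
  ... | yes refl = _ , n≤1+n _ , p
  ... | no x≢t   = _ , ≤-refl , ∈N⇒adj (N-t⊆ (x∈p∧x≢y⇒x∈p-y (adj⇒∈N s~x) x≢t)) ∷ p

  dist-mono : ∀ {s t w m m′} → N G s - t ⊆ N G t → w ≢ s →
              IsDist G s w m → IsDist G t w m′ → m′ ≤ m
  dist-mono N-t⊆ w≢s (p , _) (_ , minimal′) with walk-transfer N-t⊆ w≢s p
  ... | ℓ′ , ℓ′≤m , p′ = ≤-trans (minimal′ ℓ′ p′) ℓ′≤m

  inducedP₃-unseparated : ∀ {a x y} → InducedP₃ G a x y → ¬ SameDist G a x y
  inducedP₃-unseparated (_ , x~y , a≢y , a≁y) (_ , (p , _) , (_ , minimal)) =
    short p (minimal 1 (x~y ∷ []))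
    where
    short : ∀ {m} → Walk G _ _ m → m ≤ 1 → ⊥
    short []          _        = a≢y refl
    short (a~y ∷ [])  _        = a≁y a~y
    short (_ ∷ _ ∷ _) (s≤s ())

  ≡⊎≡⊎∈⊤-a-b : (a b c : Fin n) → c ≡ a ⊎ c ≡ b ⊎ c ∈ ⊤ - a - b
  ≡⊎≡⊎∈⊤-a-b a b c with c ≟ᶠ a | c ≟ᶠ b
  ... | yes c≡a | _       = inj₁ c≡a
  ... | no _    | yes c≡b = inj₂ (inj₁ c≡b)
  ... | no c≢a  | no c≢b  = inj₂ (inj₂ (x∈p∧x≢y⇒x∈p-y (x∈p∧x≢y⇒x∈p-y ∈⊤ c≢a) c≢b))

  -- Every vertex of W is separated from all others by itself.
  separated⇒resolving : ∀ {a b} → ¬ (∀ w → w ∈ ⊤ - a - b → SameDist G a b w) →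
                        Resolving G (⊤ - a - b)
  separated⇒resolving {a} {b} sep p q same
    with ≡⊎≡⊎∈⊤-a-b a b p | ≡⊎≡⊎∈⊤-a-b a b q
  ... | inj₂ (inj₂ p∈W)  | _                = sameDist-self (same p p∈W)
  ... | _                | inj₂ (inj₂ q∈W)  = sym (sameDist-self (sameDist-sym (same q q∈W)))
  ... | inj₁ refl        | inj₁ refl        = refl
  ... | inj₂ (inj₁ refl) | inj₂ (inj₁ refl) = refl
  ... | inj₁ refl        | inj₂ (inj₁ refl) = contradiction same sep
  ... | inj₂ (inj₁ refl) | inj₁ refl        = contradiction (λ w w∈ → sameDist-sym (same w w∈)) sep

  inducedP₃⇒resolving : ∀ {a x y} → InducedP₃ G a x y → Resolving G (⊤ - a - x)
  inducedP₃⇒resolving {a} {x} {y} P₃@(_ , x~y , a≢y , _) =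
    separated⇒resolving λ same → inducedP₃-unseparated P₃ (same y y∈W)
    where
    y∈W : y ∈ ⊤ - a - x
    y∈W = x∈p∧x≢y⇒x∈p-y (x∈p∧x≢y⇒x∈p-y ∈⊤ (λ y≡a → a≢y (sym y≡a)))
                        (λ y≡x → adj⇒≢ x~y (sym y≡x))

  geodesic⇒inducedP₃ : ∀ {a b m} → IsDist G a b m → a ≢ b → ¬ Adj G a b → ∃₂ (InducedP₃ G a)
  geodesic⇒inducedP₃ ([] , _)                     a≢b _   = contradiction refl a≢b
  geodesic⇒inducedP₃ (a~b ∷ [] , _)               _   a≁b = contradiction a~b a≁b
  geodesic⇒inducedP₃ (a~x ∷ x~y ∷ rest , minimal) _   _   =
    _ , _ , a~x , x~y ,
    (λ { refl → 1+n≰n (≤-trans (n≤1+n _) (minimal _ rest)) }) ,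
    (λ a~y → 1+n≰n (s≤s⁻¹ (minimal _ (a~y ∷ rest))))

  adjacent-if-distinct? : ∀ a b → Dec (a ≢ b → Adj G a b)
  adjacent-if-distinct? a b = ¬? (a ≟ᶠ b) →-dec adj? a b

  ¬complete⇒nonadjacent : ¬ Complete G → ∃₂ λ a b → a ≢ b × ¬ Adj G a b
  ¬complete⇒nonadjacent ¬complete with ¬∀⟶∃¬ n _ (λ a → all? (adjacent-if-distinct? a)) ¬complete
  ... | a , ¬∀b with ¬∀⟶∃¬ n _ (adjacent-if-distinct? a) ¬∀b
  ... | b , ¬adj = a , b , (λ a≡b → ¬adj λ a≢b → contradiction a≡b a≢b) , (λ a~b → ¬adj λ _ → a~b)

  module _ (connected : Connected G) where

    ¬complete⇒inducedP₃ : ¬ Complete G → ∃ λ a → ∃₂ (InducedP₃ G a)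
    ¬complete⇒inducedP₃ ¬complete with ¬complete⇒nonadjacent ¬complete
    ... | a , b , a≢b , a≁b with walk⇒dist (proj₂ (connected a b))
    ... | _ , geodesic = a , geodesic⇒inducedP₃ geodesic a≢b a≁b

    twins⇒sameDist : ∀ {u v w} → N G v ─ ⁅ u ⁆ ≡ N G u ─ ⁅ v ⁆ → w ≢ u → w ≢ v →
                     SameDist G u v w
    twins⇒sameDist {u} {v} {w} twins w≢u w≢v
      with walk⇒dist (proj₂ (connected u w)) | walk⇒dist (proj₂ (connected v w))
    ... | m , du | m′ , dv = m , du , subst (IsDist G v w) m′≡m dv
      where
      m′≡m : m′ ≡ m
      m′≡m = ≤-antisym (dist-mono (twins⇒N-u⊆N (sym twins)) w≢u du dv)
                       (dist-mono (twins⇒N-u⊆N twins) w≢v dv du)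

    twins⇒¬resolving : ∀ {u v W} → u ≢ v → N G v ─ ⁅ u ⁆ ≡ N G u ─ ⁅ v ⁆ →
                       u ∉ W → v ∉ W → ¬ Resolving G W
    twins⇒¬resolving u≢v twins u∉W v∉W resolving =
      u≢v (resolving _ _ λ w w∈W →
        twins⇒sameDist twins (λ { refl → u∉W w∈W }) (λ { refl → v∉W w∈W }))

mainTheorem2 : (n : ℕ) (G : Graph n) → Connected G → (∃ λ k → RandomlyDim G k) → ¬ Complete G →
    ∀ (u v : Fin n) → u ≢ v → N G v ─ ⁅ u ⁆ ≢ N G u ─ ⁅ v ⁆
mainTheorem2 n G connected (k , ((_ , basis-minimal) , random)) ¬complete u v u≢v twins
  with ¬complete⇒inducedP₃ G connected ¬complete
... | a , x , _ , P₃@(a~x , _) with subset-of-size (⊤ - u - v) k≤n∸2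
  where
  k≤n∸2 : k ≤ ∣ ⊤ - u - v ∣
  k≤n∸2 = subst (k ≤_) (trans (∣⊤-x-y∣≡n∸2 (adj⇒≢ G a~x)) (sym (∣⊤-x-y∣≡n∸2 u≢v)))
                (basis-minimal _ (inducedP₃⇒resolving G P₃))
... | T , T⊆ , ∣T∣≡k =
  twins⇒¬resolving G connected u≢v twins
    (λ u∈T → x∈q⇒x∉p─q ⊤ ⁅ u ⁆ (x∈⁅x⁆ u) (p─q⊆p (⊤ - u) ⁅ v ⁆ (T⊆ u∈T)))
    (λ v∈T → x∈q⇒x∉p─q (⊤ - u) ⁅ v ⁆ (x∈⁅x⁆ v) (T⊆ v∈T))
    (random T ∣T∣≡k)
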